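{- Let $t,u$ be $\lambda$-terms. (1) If $t\to_{\beta_\lambda}u$ then $t\to_{\mathtt m}\to_{\mathtt e_\lambda}u$. (2) If $t\to_{\beta_i}u$ then there are vsub-terms $r,s$ with $t\to_{\mathtt m}r\equiv s$, where $s$ is clean and $s{\downarrow}=u$.
   Context: $\lambda$-terms: $t,u::= v\mid tu$, values $v::= x\mid \lambda x.t$, up to $\alpha$; $t\{x\leftarrow u\}$ capture-avoiding substitution. Fireball calculus: fireballs $f::=\lambda x.t\mid i$, inert terms $i::= x f_1\dots f_n$ ($n\ge0$); $\to_{\beta_\lambda}$, $\to_{\beta_i}$ are closures under contexts $E::=\langle\cdot\rangle\mid tE\mid Et$ of $(\lambda x.t)(\lambda y.u)\mapsto t\{x\leftarrow \lambda y.u\}$ and $(\lambda x.t)i\mapsto t\{x\leftarrow i\}$ ($i$ inert). Value substitution calculus: vsub-terms $t,u,s::= v\mid tu\mid t[x\leftarrow u]$, vsub-values $v::=x\mid\lambda x.t$; $t[x\leftarrow u]$ binds $x$ in $t$; every $\lambda$-term is a vsub-term. Evaluation contexts $E::=\langle\cdot\rangle\mid tE\mid Et\mid E[x\leftarrow u]\mid t[x\leftarrow E]$; substitution contexts $L::=\langle\cdot\rangle\mid L[x\leftarrow u]$. $\to_{\mathtt m}$, $\to_{\mathtt e_\lambda}$ are the closures under evaluation contexts of $L\langle\lambda x.t\rangle u\mapsto L\langle t[x\leftarrow u]\rangle$ and $t[x\leftarrow L\langle \lambda y.u\rangle]\mapsto L\langle t\{x\leftarrow\lambda y.u\}\rangle$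 (bound variables of $L$ not free in $u$, resp. $t$). Structural equivalence $\equiv$: least equivalence on vsub-terms closed under evaluation contexts containing $t[y\leftarrow s][x\leftarrow u]\equiv t[x\leftarrow u][y\leftarrow s]$ ($y\notin\mathrm{fv}(u)$, $x\notin\mathrm{fv}(s)$); $t\,(s[x\leftarrow u])\equiv (ts)[x\leftarrow u]$ ($x\notin\mathrm{fv}(t)$); $t[x\leftarrow u]\,s\equiv (ts)[x\leftarrow u]$ ($x\notin\mathrm{fv}(s)$); $t[x\leftarrow u[y\leftarrow s]]\equiv t[x\leftarrow u][y\leftarrow s]$ ($y\notin\mathrm{fv}(t)$). Unfolding: $x{\downarrow}=x$, $(tu){\downarrow}=t{\downarrow}u{\downarrow}$, $(\lambda x.t){\downarrow}=\lambda x.t{\downarrow}$, $(t[x\leftarrow u]){\downarrow}=t{\downarrow}\{x\leftarrow u{\downarrow}\}$. A vsub-term is clean if it is $u[x_1\leftarrow i_1]\dots[x_n\leftarrow i_n]$ ($n\ge0$) with $u$ a $\lambda$-term and each $i_j$ an inert $\lambda$-term. $t\to_{\mathtt m}\to_{\mathtt e_\lambda}u$ means $t\to_{\mathtt m}w\to_{\mathtt e_\lambda}u$ for some $w$. -}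

module Defs where

open import Data.Nat using (ℕ; zero; suc)
open import Data.Fin using (Fin; zero; suc)
open import Function using (id; _∘_)

-- Well-scoped de Bruijn syntax: terms are identified up to α-equivalence,
-- so propositional equality _≡_ is α-equivalence.

Ren : ℕ → ℕ → Set
Ren n m = Fin n → Fin m

ext : ∀ {n m} → Ren n m → Ren (suc n) (suc m)
ext ρ zero    = zero
ext ρ (suc i) = suc (ρ i)

swap : ∀ {n} → Ren (suc (suc n)) (suc (suc n))
swap zero          = suc zero
swap (suc zero)    = zero
swap (suc (suc i)) = suc (suc i)

data Tm (n : ℕ) : Set where
  var : Fin n → Tm n
  lam : Tm (suc n) → Tm n
  app : Tm n → Tm n → Tm n

ren : ∀ {n m} → Ren n m → Tm n → Tm m
ren ρ (var i)   = var (ρ i)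
ren ρ (lam t)   = lam (ren (ext ρ) t)
ren ρ (app t u) = app (ren ρ t) (ren ρ u)

exts : ∀ {n m} → (Fin n → Tm m) → Fin (suc n) → Tm (suc m)
exts σ zero    = var zero
exts σ (suc i) = ren suc (σ i)

sub : ∀ {n m} → (Fin n → Tm m) → Tm n → Tm m
sub σ (var i)   = σ i
sub σ (lam t)   = lam (sub (exts σ) t)
sub σ (app t u) = app (sub σ t) (sub σ u)

σ₀ : ∀ {n} → Tm n → Fin (suc n) → Tm n
σ₀ u zero    = u
σ₀ u (suc i) = var i

_⟨0≔_⟩ : ∀ {n} → Tm (suc n) → Tm n → Tm n
t ⟨0≔ u ⟩ = sub (σ₀ u) t

mutual
  data Fireball {n : ℕ} : Tm n → Set where
    fb-lam   : (t : Tm (suc n)) → Fireball (lam t)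
    fb-inert : {i : Tm n} → Inert i → Fireball i

  data Inert {n : ℕ} : Tm n → Set where
    in-var : (x : Fin n) → Inert (var x)
    in-app : {i f : Tm n} → Inert i → Fireball f → Inert (app i f)

data βλ-root {n : ℕ} : Tm n → Tm n → Set where
  βλ : (t : Tm (suc n)) (u : Tm (suc n)) →
       βλ-root (app (lam t) (lam u)) (t ⟨0≔ lam u ⟩)

data βi-root {n : ℕ} : Tm n → Tm n → Set where
  βi : (t : Tm (suc n)) {i : Tm n} → Inert i →
       βi-root (app (lam t) i) (t ⟨0≔ i ⟩)

data TmClo (R : ∀ {n} → Tm n → Tm n → Set) {n : ℕ} : Tm n → Tm n → Set where
  root : ∀ {t u} → R t u → TmClo R t u
  appR : ∀ {t u u'} → TmClo R u u' → TmClo R (app t u) (app t u')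
  appL : ∀ {t t' u} → TmClo R t t' → TmClo R (app t u) (app t' u)

_→βλ_ : ∀ {n} → Tm n → Tm n → Set
_→βλ_ = TmClo βλ-root

_→βi_ : ∀ {n} → Tm n → Tm n → Set
_→βi_ = TmClo βi-root

-- Value substitution calculus:  t ::= x | λx.t | t u | t[x←u]
-- esub t u  represents  t[x←u], where x is index 0 of t.

data VTm (n : ℕ) : Set where
  vvar : Fin n → VTm n
  vlam : VTm (suc n) → VTm n
  vapp : VTm n → VTm n → VTm n
  esub : VTm (suc n) → VTm n → VTm n

vren : ∀ {n m} → Ren n m → VTm n → VTm m
vren ρ (vvar i)   = vvar (ρ i)
vren ρ (vlam t)   = vlam (vren (ext ρ) t)
vren ρ (vapp t u) = vapp (vren ρ t) (vren ρ u)
vren ρ (esub t u) = esub (vren (ext ρ) t) (vren ρ u)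

vexts : ∀ {n m} → (Fin n → VTm m) → Fin (suc n) → VTm (suc m)
vexts σ zero    = vvar zero
vexts σ (suc i) = vren suc (σ i)

vsub : ∀ {n m} → (Fin n → VTm m) → VTm n → VTm m
vsub σ (vvar i)   = σ i
vsub σ (vlam t)   = vlam (vsub (vexts σ) t)
vsub σ (vapp t u) = vapp (vsub σ t) (vsub σ u)
vsub σ (esub t u) = esub (vsub (vexts σ) t) (vsub σ u)

vσ₀ : ∀ {n} → VTm n → Fin (suc n) → VTm n
vσ₀ u zero    = u
vσ₀ u (suc i) = vvar i

_⟪0≔_⟫ : ∀ {n} → VTm (suc n) → VTm n → VTm n
t ⟪0≔ u ⟫ = vsub (vσ₀ u) t

⌜_⌝ : ∀ {n} → Tm n → VTm n
⌜ var i ⌝   = vvar i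
⌜ lam t ⌝   = vlam ⌜ t ⌝
⌜ app t u ⌝ = vapp ⌜ t ⌝ ⌜ u ⌝

-- substitution contexts  L ::= ⟨·⟩ | L[x←u]
-- SCtx n m : the whole term lives in scope n, the hole in scope m.
data SCtx : ℕ → ℕ → Set where
  hole : ∀ {n} → SCtx n n
  _[←_] : ∀ {n m} → SCtx (suc n) m → VTm n → SCtx n m

plugL : ∀ {n m} → SCtx n m → VTm m → VTm n
plugL hole       t = t
plugL (L [← u ]) t = esub (plugL L t) u

-- weakening past the binders of L (bound variables of L are fresh)
wkL : ∀ {n m} → SCtx n m → Ren n m
wkL hole       = id
wkL (L [← u ]) = wkL L ∘ suc

-- L⟨λx.t⟩ u  ↦  L⟨t[x←u]⟩
data m-root {n : ℕ} : VTm n → VTm n → Set where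
  mr : ∀ {m} (L : SCtx n m) (t : VTm (suc m)) (u : VTm n) →
       m-root (vapp (plugL L (vlam t)) u)
              (plugL L (esub t (vren (wkL L) u)))

-- t[x←L⟨λy.u⟩]  ↦  L⟨t{x←λy.u}⟩
data eλ-root {n : ℕ} : VTm n → VTm n → Set where
  er : ∀ {m} (L : SCtx n m) (t : VTm (suc n)) (u : VTm (suc m)) →
       eλ-root (esub t (plugL L (vlam u)))
               (plugL L ((vren (ext (wkL L)) t) ⟪0≔ vlam u ⟫))

data EvClo (R : ∀ {n} → VTm n → VTm n → Set) : ∀ {n} → VTm n → VTm n → Set where
  root  : ∀ {n} {t u : VTm n} → R t u → EvClo R t u
  appR  : ∀ {n} {t u u' : VTm n} → EvClo R u u' → EvClo R (vapp t u) (vapp t u')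
  appL  : ∀ {n} {t t' u : VTm n} → EvClo R t t' → EvClo R (vapp t u) (vapp t' u)
  esubL : ∀ {n} {t t' : VTm (suc n)} {u : VTm n} →
          EvClo R t t' → EvClo R (esub t u) (esub t' u)
  esubR : ∀ {n} {t : VTm (suc n)} {u u' : VTm n} →
          EvClo R u u' → EvClo R (esub t u) (esub t u')

_→m_ : ∀ {n} → VTm n → VTm n → Set
_→m_ = EvClo m-root

_→eλ_ : ∀ {n} → VTm n → VTm n → Set
_→eλ_ = EvClo eλ-root

-- Structural equivalence: least equivalence, closed under evaluation
-- contexts, containing the four axioms (side conditions on free
-- variables are expressed by weakening).

data _≡s_ : ∀ {n} → VTm n → VTm n → Set where
  -- t[y←s][x←u] ≡ t[x←u][y←s]   (y ∉ fv u, x ∉ fv s)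
  ax-com : ∀ {n} (t : VTm (suc (suc n))) (s u : VTm n) →
           esub (esub t (vren suc s)) u ≡s esub (esub (vren swap t) (vren suc u)) s
  -- t (s[x←u]) ≡ (t s)[x←u]   (x ∉ fv t)
  ax-appr  : ∀ {n} (t : VTm n) (s : VTm (suc n)) (u : VTm n) →
           vapp t (esub s u) ≡s esub (vapp (vren suc t) s) u
  -- t[x←u] s ≡ (t s)[x←u]   (x ∉ fv s)
  ax-appl  : ∀ {n} (t : VTm (suc n)) (u s : VTm n) →
           vapp (esub t u) s ≡s esub (vapp t (vren suc s)) u
  -- t[x←u[y←s]] ≡ t[x←u][y←s]   (y ∉ fv t)
  ax-[·] : ∀ {n} (t : VTm (suc n)) (u : VTm (suc n)) (s : VTm n) →
           esub t (esub u s) ≡s esub (esub (vren (ext suc) t) u) s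
  ≡s-refl  : ∀ {n} {t : VTm n} → t ≡s t
  ≡s-sym   : ∀ {n} {t u : VTm n} → t ≡s u → u ≡s t
  ≡s-trans : ∀ {n} {t u s : VTm n} → t ≡s u → u ≡s s → t ≡s s
  ≡s-appR  : ∀ {n} {t u u' : VTm n} → u ≡s u' → vapp t u ≡s vapp t u'
  ≡s-appL  : ∀ {n} {t t' u : VTm n} → t ≡s t' → vapp t u ≡s vapp t' u
  ≡s-esubL : ∀ {n} {t t' : VTm (suc n)} {u : VTm n} →
             t ≡s t' → esub t u ≡s esub t' u
  ≡s-esubR : ∀ {n} {t : VTm (suc n)} {u u' : VTm n} →
             u ≡s u' → esub t u ≡s esub t u'

_↓ : ∀ {n} → VTm n → Tm n
vvar x ↓   = var x
vlam t ↓   = lam (t ↓)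
vapp t u ↓ = app (t ↓) (u ↓)
esub t u ↓ = (t ↓) ⟨0≔ u ↓ ⟩

data Clean : ∀ {n} → VTm n → Set where
  cl-base : ∀ {n} (u : Tm n) → Clean ⌜ u ⌝
  cl-esub : ∀ {n} {s : VTm (suc n)} {i : Tm n} →
            Clean s → Inert i → Clean (esub s ⌜ i ⌝)

-- A β-step on a value (λ or inert) is, in the value substitution calculus,
-- a multiplicative step creating the explicit substitution [x←v], followed
-- for an abstraction v by the exponential step that performs it.  An inert v
-- cannot be substituted, so [x←v] stays; when the redex sits under
-- applications, the structural equivalence floats it (and the others already
-- floated) out of them, producing a clean term whose unfolding is the
-- contractum.
module Submission where

open import Defs
open import Data.Nat using (ℕ; suc)
open import Data.Fin using (Fin; zero; suc)
open import Data.Product using (Σ; _×_; _,_)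
open import Function using (id; _∘_)
open import Relation.Binary.PropositionalEquality
  using (_≡_; refl; sym; trans; cong; cong₂; subst)

exts-cong : ∀ {n m} {σ σ' : Fin n → Tm m} →
            (∀ i → σ i ≡ σ' i) → ∀ i → exts σ i ≡ exts σ' i
exts-cong h zero    = refl
exts-cong h (suc i) = cong (ren suc) (h i)

sub-cong : ∀ {n m} {σ σ' : Fin n → Tm m} →
           (∀ i → σ i ≡ σ' i) → ∀ t → sub σ t ≡ sub σ' t
sub-cong h (var i)   = h i
sub-cong h (lam t)   = cong lam (sub-cong (exts-cong h) t)
sub-cong h (app t u) = cong₂ app (sub-cong h t) (sub-cong h u)

exts-ext : ∀ {n m k} (σ : Fin m → Tm k) (ρ : Ren n m) →
           ∀ i → exts σ (ext ρ i) ≡ exts (σ ∘ ρ) i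
exts-ext σ ρ zero    = refl
exts-ext σ ρ (suc i) = refl

sub-ren : ∀ {n m k} (σ : Fin m → Tm k) (ρ : Ren n m) →
          ∀ t → sub σ (ren ρ t) ≡ sub (σ ∘ ρ) t
sub-ren σ ρ (var i)   = refl
sub-ren σ ρ (lam t)   =
  cong lam (trans (sub-ren (exts σ) (ext ρ) t) (sub-cong (exts-ext σ ρ) t))
sub-ren σ ρ (app t u) = cong₂ app (sub-ren σ ρ t) (sub-ren σ ρ u)

exts-var : ∀ {n} (i : Fin (suc n)) → exts var i ≡ var i
exts-var zero    = refl
exts-var (suc i) = refl

sub-var : ∀ {n} (t : Tm n) → sub var t ≡ t
sub-var (var i)   = refl
sub-var (lam t)   = cong lam (trans (sub-cong exts-var t) (sub-var t))
sub-var (app t u) = cong₂ app (sub-var t) (sub-var u)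

wk-⟨0≔⟩ : ∀ {n} (t u : Tm n) → ren suc t ⟨0≔ u ⟩ ≡ t
wk-⟨0≔⟩ t u = trans (sub-ren (σ₀ u) suc t) (sub-var t)

ext-cong : ∀ {n m} {ρ ρ' : Ren n m} →
           (∀ i → ρ i ≡ ρ' i) → ∀ i → ext ρ i ≡ ext ρ' i
ext-cong h zero    = refl
ext-cong h (suc i) = cong suc (h i)

vren-cong : ∀ {n m} {ρ ρ' : Ren n m} →
            (∀ i → ρ i ≡ ρ' i) → ∀ t → vren ρ t ≡ vren ρ' t
vren-cong h (vvar i)   = cong vvar (h i)
vren-cong h (vlam t)   = cong vlam (vren-cong (ext-cong h) t)
vren-cong h (vapp t u) = cong₂ vapp (vren-cong h t) (vren-cong h u)
vren-cong h (esub t u) = cong₂ esub (vren-cong (ext-cong h) t) (vren-cong h u)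

ext-id : ∀ {n} (i : Fin (suc n)) → ext id i ≡ i
ext-id zero    = refl
ext-id (suc i) = refl

vren-id : ∀ {n} (t : VTm n) → vren id t ≡ t
vren-id (vvar i)   = refl
vren-id (vlam t)   = cong vlam (trans (vren-cong ext-id t) (vren-id t))
vren-id (vapp t u) = cong₂ vapp (vren-id t) (vren-id u)
vren-id (esub t u) = cong₂ esub (trans (vren-cong ext-id t) (vren-id t)) (vren-id u)

vexts-cong : ∀ {n m} {σ σ' : Fin n → VTm m} →
             (∀ i → σ i ≡ σ' i) → ∀ i → vexts σ i ≡ vexts σ' i
vexts-cong h zero    = refl
vexts-cong h (suc i) = cong (vren suc) (h i)

vsub-cong : ∀ {n m} {σ σ' : Fin n → VTm m} →
            (∀ i → σ i ≡ σ' i) → ∀ t → vsub σ t ≡ vsub σ' t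
vsub-cong h (vvar i)   = h i
vsub-cong h (vlam t)   = cong vlam (vsub-cong (vexts-cong h) t)
vsub-cong h (vapp t u) = cong₂ vapp (vsub-cong h t) (vsub-cong h u)
vsub-cong h (esub t u) = cong₂ esub (vsub-cong (vexts-cong h) t) (vsub-cong h u)

⌜⌝-ren : ∀ {n m} (ρ : Ren n m) (t : Tm n) → ⌜ ren ρ t ⌝ ≡ vren ρ ⌜ t ⌝
⌜⌝-ren ρ (var i)   = refl
⌜⌝-ren ρ (lam t)   = cong vlam (⌜⌝-ren (ext ρ) t)
⌜⌝-ren ρ (app t u) = cong₂ vapp (⌜⌝-ren ρ t) (⌜⌝-ren ρ u)

⌜⌝-exts : ∀ {n m} (σ : Fin n → Tm m) →
          ∀ i → ⌜ exts σ i ⌝ ≡ vexts (⌜_⌝ ∘ σ) i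
⌜⌝-exts σ zero    = refl
⌜⌝-exts σ (suc i) = ⌜⌝-ren suc (σ i)

⌜⌝-sub : ∀ {n m} (σ : Fin n → Tm m) (t : Tm n) →
         ⌜ sub σ t ⌝ ≡ vsub (⌜_⌝ ∘ σ) ⌜ t ⌝
⌜⌝-sub σ (var i)   = refl
⌜⌝-sub σ (lam t)   =
  cong vlam (trans (⌜⌝-sub (exts σ) t) (vsub-cong (⌜⌝-exts σ) ⌜ t ⌝))
⌜⌝-sub σ (app t u) = cong₂ vapp (⌜⌝-sub σ t) (⌜⌝-sub σ u)

⌜⌝-σ₀ : ∀ {n} (u : Tm n) → ∀ i → ⌜ σ₀ u i ⌝ ≡ vσ₀ ⌜ u ⌝ i
⌜⌝-σ₀ u zero    = refl
⌜⌝-σ₀ u (suc i) = refl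

⌜⌝-⟨0≔⟩ : ∀ {n} (t : Tm (suc n)) (u : Tm n) → ⌜ t ⟨0≔ u ⟩ ⌝ ≡ ⌜ t ⌝ ⟪0≔ ⌜ u ⌝ ⟫
⌜⌝-⟨0≔⟩ t u = trans (⌜⌝-sub (σ₀ u) t) (vsub-cong (⌜⌝-σ₀ u) ⌜ t ⌝)

⌜⌝-↓ : ∀ {n} (t : Tm n) → ⌜ t ⌝ ↓ ≡ t
⌜⌝-↓ (var i)   = refl
⌜⌝-↓ (lam t)   = cong lam (⌜⌝-↓ t)
⌜⌝-↓ (app t u) = cong₂ app (⌜⌝-↓ t) (⌜⌝-↓ u)

→m-hole : ∀ {n} (t : VTm (suc n)) (u : VTm n) → vapp (vlam t) u →m esub t u
→m-hole t u = subst (λ u' → vapp (vlam t) u →m esub t u') (vren-id u) (root (mr hole t u))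

→eλ-hole : ∀ {n} (t : VTm (suc n)) (u : VTm (suc n)) →
           esub t (vlam u) →eλ (t ⟪0≔ vlam u ⟫)
→eλ-hole t u =
  subst (λ t' → esub t (vlam u) →eλ (t' ⟪0≔ vlam u ⟫))
        (trans (vren-cong ext-id t) (vren-id t))
        (root (er hole t u))

_≡Clean↓_ : ∀ {n} → VTm n → Tm n → Set
_≡Clean↓_ {n} r u = Σ (VTm n) (λ s → (r ≡s s) × Clean s × (s ↓ ≡ u))

Clean-appR : ∀ {n} (a : Tm n) {s : VTm n} → Clean s → vapp ⌜ a ⌝ s ≡Clean↓ app a (s ↓)
Clean-appR a (cl-base v) =
  ⌜ app a v ⌝ , ≡s-refl , cl-base (app a v) , cong (λ a' → app a' (⌜ v ⌝ ↓)) (⌜⌝-↓ a)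
Clean-appR a (cl-esub {s = s} {i = i} c inert) with Clean-appR (ren suc a) c
... | s' , as≡s' , c' , s'↓ =
  esub s' ⌜ i ⌝ ,
  ≡s-trans (ax-appr ⌜ a ⌝ s ⌜ i ⌝)
    (≡s-esubL (subst (λ a' → vapp a' s ≡s s') (⌜⌝-ren suc a) as≡s')) ,
  cl-esub c' inert ,
  trans (cong (_⟨0≔ ⌜ i ⌝ ↓ ⟩) s'↓)
        (cong (λ a' → app a' ((s ↓) ⟨0≔ ⌜ i ⌝ ↓ ⟩)) (wk-⟨0≔⟩ a (⌜ i ⌝ ↓)))

Clean-appL : ∀ {n} (a : Tm n) {s : VTm n} → Clean s → vapp s ⌜ a ⌝ ≡Clean↓ app (s ↓) a
Clean-appL a (cl-base v) =
  ⌜ app v a ⌝ , ≡s-refl , cl-base (app v a) , cong (app (⌜ v ⌝ ↓)) (⌜⌝-↓ a)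
Clean-appL a (cl-esub {s = s} {i = i} c inert) with Clean-appL (ren suc a) c
... | s' , sa≡s' , c' , s'↓ =
  esub s' ⌜ i ⌝ ,
  ≡s-trans (ax-appl s ⌜ i ⌝ ⌜ a ⌝)
    (≡s-esubL (subst (λ a' → vapp s a' ≡s s') (⌜⌝-ren suc a) sa≡s')) ,
  cl-esub c' inert ,
  trans (cong (_⟨0≔ ⌜ i ⌝ ↓ ⟩) s'↓)
        (cong (app ((s ↓) ⟨0≔ ⌜ i ⌝ ↓ ⟩)) (wk-⟨0≔⟩ a (⌜ i ⌝ ↓)))

≡Clean↓-appR : ∀ {n} (a : Tm n) {r : VTm n} {u : Tm n} →
               r ≡Clean↓ u → vapp ⌜ a ⌝ r ≡Clean↓ app a u
≡Clean↓-appR a (_ , r≡s , c , refl) with Clean-appR a c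
... | s' , as≡s' , c' , s'↓ = s' , ≡s-trans (≡s-appR r≡s) as≡s' , c' , s'↓

≡Clean↓-appL : ∀ {n} (a : Tm n) {r : VTm n} {u : Tm n} →
               r ≡Clean↓ u → vapp r ⌜ a ⌝ ≡Clean↓ app u a
≡Clean↓-appL a (_ , r≡s , c , refl) with Clean-appL a c
... | s' , sa≡s' , c' , s'↓ = s' , ≡s-trans (≡s-appL r≡s) sa≡s' , c' , s'↓

βλ-simulation : ∀ {n} {t u : Tm n} → t →βλ u →
                Σ (VTm n) (λ w → (⌜ t ⌝ →m w) × (w →eλ ⌜ u ⌝))
βλ-simulation (root (βλ t u)) =
  esub ⌜ t ⌝ (vlam ⌜ u ⌝) ,
  →m-hole ⌜ t ⌝ (vlam ⌜ u ⌝) ,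
  subst (esub ⌜ t ⌝ (vlam ⌜ u ⌝) →eλ_) (sym (⌜⌝-⟨0≔⟩ t (lam u))) (→eλ-hole ⌜ t ⌝ ⌜ u ⌝)
βλ-simulation (appR step) with βλ-simulation step
... | _ , m , e = _ , appR m , appR e
βλ-simulation (appL step) with βλ-simulation step
... | _ , m , e = _ , appL m , appL e

βi-simulation : ∀ {n} {t u : Tm n} → t →βi u →
                Σ (VTm n) (λ r → (⌜ t ⌝ →m r) × (r ≡Clean↓ u))
βi-simulation (root (βi t {i} inert)) =
  esub ⌜ t ⌝ ⌜ i ⌝ ,
  →m-hole ⌜ t ⌝ ⌜ i ⌝ ,
  esub ⌜ t ⌝ ⌜ i ⌝ , ≡s-refl , cl-esub (cl-base t) inert ,
  cong₂ _⟨0≔_⟩ (⌜⌝-↓ t) (⌜⌝-↓ i)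
βi-simulation (appR {t = a} step) with βi-simulation step
... | _ , m , r≡u = _ , appR m , ≡Clean↓-appR a r≡u
βi-simulation (appL {u = a} step) with βi-simulation step
... | _ , m , r≡u = _ , appL m , ≡Clean↓-appL a r≡u

lemma2 : ∀ {n : ℕ} (t u : Tm n) →
    (t →βλ u → Σ (VTm n) (λ w → (⌜ t ⌝ →m w) × (w →eλ ⌜ u ⌝)))
    × (t →βi u → Σ (VTm n) (λ r → Σ (VTm n) (λ s →
         (⌜ t ⌝ →m r) × (r ≡s s) × Clean s × (s ↓ ≡ u))))
lemma2 t u = βλ-simulation , βi-case
  where
    βi-case : t →βi u → Σ (VTm _) (λ r → Σ (VTm _) (λ s →
                (⌜ t ⌝ →m r) × (r ≡s s) × Clean s × (s ↓ ≡ u)))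
    βi-case step with βi-simulation step
    ... | r , m , s , r≡s , c , s↓ = r , s , m , r≡s , c , s↓
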